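{- Let $q \colon X^* \to R$ and $t = \mathsf{hBR}_{\langle\,\rangle}(q)$. Let $a_0, \ldots, a_n \colon X$ be a finite sequence such that for all $i \leq n$, $a_i \in \varepsilon_{\langle a_0, \ldots, a_{i-1}\rangle}(p_i)$, where \[ p_i(y) = \bigcup \{ q_{\langle a_0, \ldots, a_{i-1}, y\rangle}(r) \;:\; r \in \mathsf{hBR}_{\langle a_0, \ldots, a_{i-1}, y\rangle}(q_{\langle a_0, \ldots, a_{i-1}, y\rangle}) \}. \] If $\omega(\langle a_0, \ldots, a_{i-1}\rangle^+) \geq i$ for all $i \leq n$, then \[ \langle a_0, \ldots, a_{n-1}\rangle * x * r \in t \] for all $x \in \varepsilon_{\langle a_0, \ldots, a_{n-1}\rangle}(p_n)$ and all $r \in \mathsf{hBR}_{\langle a_0, \ldots, a_{n-1}, x\rangle}(q_{\langle a_0, \ldots, a_{n-1}, x\rangle})$.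
   Context: $X$ is a type with a default element $\mathbf{0}$, $R = \mathcal{P}(R')$ is the type of finite subsets of some type $R'$, and $\mathcal{P}(Y)$ denotes finite subsets of $Y$. For a finite sequence $s \colon X^*$, $|s|$ is its length, $s^+ \colon X^{\mathbb{N}}$ its extension by infinitely many $\mathbf{0}$'s, $s*x$ appends $x$, $x*r$ prepends, and $u*r$ is concatenation. For $q \colon X^* \to R$ and $u \colon X^*$ (or $u = x \colon X$ viewed as a one-element sequence), $q_u(r) = q(u*r)$. Fix $\omega \colon X^{\mathbb{N}} \to \mathbb{N}$ and $\varepsilon \colon X^* \to ((X \to R) \to \mathcal{P}(X))$ (written $\varepsilon_s$). $\mathsf{hBR}_s(q) \in \mathcal{P}(X^*)$, for $s \colon X^*$ and $q \colon X^* \to R$, is a functional satisfying for all $s,q$: $\mathsf{hBR}_s(q) = \{\langle\,\rangle\}$ if $\omega(s^+) < |s|$, and otherwise $\mathsf{hBR}_s(q) = \{ a * r : a \in \chi,\ r \in \mathsf{hBR}_{s*a}(q_a)\}$ where $\chi = \varepsilon_s\big(\lambda x . \bigcup\{ q_x(r) : r \in \mathsf{hBR}_{s*x}(q_x)\}\big)$. -}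

module Defs where

open import Data.Nat using (ℕ; zero; suc; _<_; _≤_)
open import Data.List using (List; []; _∷_; _++_; _∷ʳ_; length; concatMap; applyUpTo)
open import Data.List.Membership.Propositional using (_∈_)
open import Data.Product using (Σ; _×_; _,_)
open import Relation.Binary.PropositionalEquality using (_≡_)
open import Function.Bundles using (_⇔_)

-- Finite subsets P(Y) are represented by lists, with membership _∈_ ;
-- equality of finite sets is membership-equivalence.
-- X* = List X, R = List R' (finite subsets of R').

ext : {X : Set} → X → List X → ℕ → X
ext 𝟎 [] _ = 𝟎
ext 𝟎 (x ∷ s) zero = x
ext 𝟎 (x ∷ s) (suc i) = ext 𝟎 s i

shift : {X R' : Set} → (List X → List R') → List X → List X → List R'
shift q u r = q (u ++ r)

bigUnion : {X R' : Set}
  → (List X → (List X → List R') → List (List X))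
  → (List X → List R') → List X → List R'
bigUnion hBR q u = concatMap (λ r → shift q u r) (hBR u (shift q u))

-- The defining equations of hBR, as set equalities (membership-equivalence).
IsHBR : {X R' : Set} → X → (( ℕ → X) → ℕ)
  → (List X → (X → List R') → List X)
  → (List X → (List X → List R') → List (List X)) → Set
IsHBR {X} {R'} 𝟎 ω ε hBR =
  (s : List X) (q : List X → List R') →
    (ω (ext 𝟎 s) < length s → (u : List X) → (u ∈ hBR s q) ⇔ (u ≡ []))
  × (length s ≤ ω (ext 𝟎 s) → (u : List X) →
       (u ∈ hBR s q) ⇔
       Σ X (λ a → Σ (List X) (λ r →
          (a ∈ ε s (λ x → concatMap (λ r′ → shift q (x ∷ []) r′)
                                    (hBR (s ∷ʳ x) (shift q (x ∷ []))))
          × (r ∈ hBR (s ∷ʳ a) (shift q (a ∷ []))) × (u ≡ a ∷ r)))))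

prefix : {X : Set} → (ℕ → X) → ℕ → List X
prefix a i = applyUpTo a i

pFun : {X R' : Set}
  → (List X → (List X → List R') → List (List X))
  → (List X → List R') → (ℕ → X) → ℕ → X → List R'
pFun hBR q a i y = bigUnion hBR q (prefix a i ∷ʳ y)

module Submission where

-- Idea: t = hBR⟨⟩(q) contains ⟨a₀,…,a_{n-1}⟩ * x * r because the path can be
-- rebuilt from the bottom up: at every open node s (|s| ≤ ω(s⁺)) the
-- recursion equation of hBR, read backwards, says that b * r ∈ hBR_s(Q)
-- whenever b is an ε_s-choice and r ∈ hBR_{s*b}(Q_b)  (hBR-cons).
-- To induct on n we generalise from the root to an arbitrary node s with an
-- arbitrary outcome function Q: the hypotheses become "the play a follows ε
-- from s" (Follows) and "x, r continue the play" (Continues).  Peeling the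
-- first move a₀ off the play moves these hypotheses from (s, Q, a) to
-- (s * a₀, Q_{a₀}, a ∘ suc); since ε is applied to functions, only the
-- position s may be transported along a list equation, so the outcome
-- functions p_i are written relative to the ancestor Q (outcomes), making
-- the shifted hypotheses definitionally the original ones.

open import Defs
open import Data.Nat using (ℕ; zero; suc; _≤_; z≤n; s≤s)
open import Data.List using (List; []; _∷_; _++_; _∷ʳ_; length; concatMap)
open import Data.List.Properties using (++-assoc; ++-identityʳ; length-applyUpTo)
open import Data.List.Membership.Propositional using (_∈_)
open import Data.Product using (_×_; _,_; proj₁; proj₂)
open import Function using (_∘_)
open import Function.Bundles using (Equivalence)
open import Relation.Binary.PropositionalEquality using (refl; sym; subst)

module Paths {X R' : Set} (𝟎 : X) (ω : (ℕ → X) → ℕ)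
    (ε : List X → (X → List R') → List X)
    (hBR : List X → (List X → List R') → List (List X))
    (isHBR : IsHBR 𝟎 ω ε hBR) where

  Open : List X → Set
  Open s = length s ≤ ω (ext 𝟎 s)

  -- The function p(y) = ⋃ {Q_{L*y}(r) : r ∈ hBR_{s*y}(Q_{L*y})} at the node s,
  -- reached by the path L from the node whose outcome function is Q.
  outcomes : List X → (List X → List R') → List X → X → List R'
  outcomes s Q L y =
    concatMap (λ r → Q ((L ∷ʳ y) ++ r)) (hBR (s ∷ʳ y) (λ r → Q ((L ∷ʳ y) ++ r)))

  hBR-cons : {s : List X} {Q : List X → List R'} {b : X} {r : List X}
    → Open s → b ∈ ε s (outcomes s Q [])
    → r ∈ hBR (s ∷ʳ b) (λ r′ → Q (b ∷ r′))
    → (b ∷ r) ∈ hBR s Q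
  hBR-cons {s} {Q} {b} {r} s-open b∈ε r∈hBR =
    Equivalence.from (proj₂ (isHBR s Q) s-open (b ∷ r)) (b , r , b∈ε , r∈hBR , refl)

  rebase : (P : List X → Set) (s : List X) (b : X) (L : List X)
    → P (s ++ (b ∷ L)) → P ((s ∷ʳ b) ++ L)
  rebase P s b L = subst P (sym (++-assoc s (b ∷ []) L))

  unbase : (P : List X → Set) (s : List X) → P (s ++ []) → P s
  unbase P s = subst P (++-identityʳ s)

  Follows : List X → (List X → List R') → (ℕ → X) → ℕ → Set
  Follows s Q a n = (i : ℕ) → i ≤ n →
    let here = s ++ prefix a i in
    Open here × a i ∈ ε here (outcomes here Q (prefix a i))

  Continues : List X → (List X → List R') → List X → X → List X → Set
  Continues s Q L x r =
    x ∈ ε (s ++ L) (outcomes (s ++ L) Q L)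
    × r ∈ hBR ((s ++ L) ∷ʳ x) (λ r′ → Q ((L ∷ʳ x) ++ r′))

  follows-head : {s : List X} {Q : List X → List R'} {a : ℕ → X} {n : ℕ}
    → Follows s Q a n → Open s × a 0 ∈ ε s (outcomes s Q [])
  follows-head {s} {Q} {a} fol =
    unbase (λ Z → Open Z × a 0 ∈ ε Z (outcomes Z Q [])) s (fol 0 z≤n)

  follows-tail : {s : List X} {Q : List X → List R'} {a : ℕ → X} {n : ℕ}
    → Follows s Q a (suc n)
    → Follows (s ∷ʳ a 0) (λ r → Q (a 0 ∷ r)) (a ∘ suc) n
  follows-tail {s} {Q} {a} fol i i≤n =
    rebase (λ Z → Open Z × a (suc i) ∈ ε Z (outcomes Z (λ r → Q (a 0 ∷ r)) L))
           s (a 0) L (fol (suc i) (s≤s i≤n))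
    where
      L : List X
      L = prefix (a ∘ suc) i

  continues-head : {s : List X} {Q : List X → List R'} {x : X} {r : List X}
    → Continues s Q [] x r
    → x ∈ ε s (outcomes s Q []) × r ∈ hBR (s ∷ʳ x) (λ r′ → Q (x ∷ r′))
  continues-head {s} {Q} {x} {r} =
    unbase (λ Z → x ∈ ε Z (outcomes Z Q [])
                  × r ∈ hBR (Z ∷ʳ x) (λ r′ → Q (x ∷ r′))) s

  continues-tail : {s : List X} {Q : List X → List R'} {b : X} {L : List X}
    {x : X} {r : List X}
    → Continues s Q (b ∷ L) x r → Continues (s ∷ʳ b) (λ r′ → Q (b ∷ r′)) L x r
  continues-tail {s} {Q} {b} {L} {x} {r} =
    rebase (λ Z → x ∈ ε Z (outcomes Z (λ r′ → Q (b ∷ r′)) L)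
                  × r ∈ hBR (Z ∷ʳ x) (λ r′ → Q (b ∷ ((L ∷ʳ x) ++ r′)))) s b L

  descend : (n : ℕ) (s : List X) (Q : List X → List R') (a : ℕ → X)
    {x : X} {r : List X}
    → Follows s Q a n → Continues s Q (prefix a n) x r
    → (prefix a n ++ (x ∷ r)) ∈ hBR s Q
  descend zero s Q a {x} {r} fol cont =
    hBR-cons (proj₁ (follows-head {s} {Q} {a} fol)) (proj₁ base) (proj₂ base)
    where
      base : x ∈ ε s (outcomes s Q []) × r ∈ hBR (s ∷ʳ x) (λ r′ → Q (x ∷ r′))
      base = continues-head {s} {Q} cont
  descend (suc n) s Q a fol cont =
    hBR-cons (proj₁ head) (proj₂ head)
      (descend n (s ∷ʳ a 0) (λ r → Q (a 0 ∷ r)) (a ∘ suc)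
        (follows-tail {s} {Q} {a} fol) (continues-tail {s} {Q} cont))
    where
      head : Open s × a 0 ∈ ε s (outcomes s Q [])
      head = follows-head {s} {Q} {a} fol

lemma4p4 : {X R' : Set} (𝟎 : X) (ω : (ℕ → X) → ℕ)
    (ε : List X → (X → List R') → List X)
    (hBR : List X → (List X → List R') → List (List X))
    → IsHBR 𝟎 ω ε hBR
    → (q : List X → List R') (n : ℕ) (a : ℕ → X)
    → ((i : ℕ) → i ≤ n → a i ∈ ε (prefix a i) (pFun hBR q a i))
    → ((i : ℕ) → i ≤ n → i ≤ ω (ext 𝟎 (prefix a i)))
    → (x : X) → x ∈ ε (prefix a n) (pFun hBR q a n)
    → (r : List X) → r ∈ hBR (prefix a n ∷ʳ x) (shift q (prefix a n ∷ʳ x))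
    → (prefix a n ++ (x ∷ r)) ∈ hBR [] q
lemma4p4 𝟎 ω ε hBR isHBR q n a choices nodesOpen x x∈ε r r∈hBR =
  descend n [] q a (λ i i≤n → openAt i i≤n , choices i i≤n) (x∈ε , r∈hBR)
  where
    open Paths 𝟎 ω ε hBR isHBR
    -- the i-th node of the play has length i
    openAt : (i : ℕ) → i ≤ n → Open (prefix a i)
    openAt i i≤n = subst (λ k → k ≤ ω (ext 𝟎 (prefix a i)))
                         (sym (length-applyUpTo a i)) (nodesOpen i i≤n)
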